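{- Let $n\ge3$ be an integer. Let $G$ be a $\{K_n,\tilde S_n\}$-free graph, let $x\in V(G)$ and let $X\subseteq N_G(x)$. Then $\mathrm{insp}(G[\{x\}\cup X])\le \xi_{n,n-2}$, where $\xi_{n,i}=\frac{(R(n-1,n)-1)^{i}-1}{R(n-1,n)-2}$.
   Context: Graphs are finite and simple. $G$ is $H$-free if it has no induced subgraph isomorphic to $H$. $N_G(x)$ is the neighborhood of $x$; $G[Y]$ is the induced subgraph on $Y$. $R(a,b)$ is the Ramsey number: the least $R$ such that every graph on at least $R$ vertices has a clique of size $a$ or an independent set of size $b$. An induced star partition of $G$ is a family of pairwise vertex-disjoint induced subgraphs of $G$, each isomorphic to $K_1$ or to some star $K_{1,m}$ ($m\ge1$), whose vertex sets cover $V(G)$; $\mathrm{insp}(G)$ is its minimum cardinality. $K_n$ is the complete graph on $n$ vertices. $\tilde S_n$ is the graph on vertices $x_1,y_1,\dots,y_n,z_1,\dots,z_n$ with edges $x_1y_i,\ y_iz_i,\ x_1z_i$ for $1\le i\le n$. -}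

module Defs where

open import Data.Nat using (ℕ; zero; suc; _+_; _*_; _∸_; _^_; _≤_; _≡ᵇ_; _<ᵇ_)
open import Data.Bool using (Bool; true; false; _∧_; _∨_; not)
open import Data.Fin using (Fin; toℕ)
open import Data.Fin.Properties using (_≟_)
open import Data.List using (List; []; _∷_; concatMap; length)
open import Data.List.Relation.Unary.All using (All)
open import Data.List.Relation.Unary.AllPairs using (AllPairs)
open import Data.List.Relation.Unary.Unique.Propositional using (Unique)
open import Data.List.Membership.Propositional using (_∈_)
open import Data.Product using (Σ; _×_; _,_)
open import Data.Sum using (_⊎_)
open import Relation.Nullary using (¬_; ⌊_⌋)
open import Relation.Binary.PropositionalEquality using (_≡_)
open import Function.Definitions using (Injective)

record Graph (N : ℕ) : Set where
  field
    adj    : Fin N → Fin N → Bool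
    sym    : ∀ u v → adj u v ≡ adj v u
    irrefl : ∀ v → adj v v ≡ false
open Graph public

InducedCopy : ∀ {k N} → (Fin k → Fin k → Bool) → Graph N → Set
InducedCopy {k} {N} H G =
  Σ (Fin k → Fin N) λ f → Injective _≡_ _≡_ f × (∀ i j → adj G (f i) (f j) ≡ H i j)

Free : ∀ {k N} → (Fin k → Fin k → Bool) → Graph N → Set
Free H G = ¬ InducedCopy H G

completeAdj : (n : ℕ) → Fin n → Fin n → Bool
completeAdj n i j = not ⌊ i ≟ j ⌋

-- The graph S~_n on Fin (1 + (n + n)):
-- vertex 0 = x_1, vertex i (1 ≤ i ≤ n) = y_i, vertex n + i = z_i.
-- Edges x_1 y_i, x_1 z_i, y_i z_i.
stildeEdge : ℕ → ℕ → ℕ → Bool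
stildeEdge n a b = ((a ≡ᵇ 0) ∧ (0 <ᵇ b)) ∨ ((0 <ᵇ a) ∧ (b ≡ᵇ (a + n)))

stildeAdj : (n : ℕ) → Fin (suc (n + n)) → Fin (suc (n + n)) → Bool
stildeAdj n u v = stildeEdge n (toℕ u) (toℕ v) ∨ stildeEdge n (toℕ v) (toℕ u)

HasClique : ∀ {N} → Graph N → ℕ → Set
HasClique {N} G a = Σ (Fin a → Fin N) λ f →
  Injective _≡_ _≡_ f × (∀ i j → ¬ i ≡ j → adj G (f i) (f j) ≡ true)

HasIndep : ∀ {N} → Graph N → ℕ → Set
HasIndep {N} G b = Σ (Fin b → Fin N) λ f →
  Injective _≡_ _≡_ f × (∀ i j → ¬ i ≡ j → adj G (f i) (f j) ≡ false)

RamseyProperty : ℕ → ℕ → ℕ → Set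
RamseyProperty a b r = ∀ N → r ≤ N → (G : Graph N) → HasClique G a ⊎ HasIndep G b

IsRamseyNumber : ℕ → ℕ → ℕ → Set
IsRamseyNumber a b r = RamseyProperty a b r × (∀ r' → RamseyProperty a b r' → r ≤ r')

-- A part of an induced star partition: a centre together with a list
-- of leaves (empty list = K_1, otherwise K_{1,m}).
Part : ℕ → Set
Part N = Fin N × List (Fin N)

partVerts : ∀ {N} → Part N → List (Fin N)
partVerts (c , ls) = c ∷ ls

IsInducedStar : ∀ {N} → Graph N → Part N → Set
IsInducedStar G (c , ls) =
  All (λ l → adj G c l ≡ true) ls × AllPairs (λ u v → adj G u v ≡ false) ls

IsInducedStarPartition : ∀ {N} → Graph N → (Fin N → Set) → List (Part N) → Set
IsInducedStarPartition {N} G S parts =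
  All (IsInducedStar G) parts
  × Unique (concatMap partVerts parts)
  × (∀ v → (v ∈ concatMap partVerts parts → S v) × (S v → v ∈ concatMap partVerts parts))

InspAtMost : ∀ {N} → Graph N → (Fin N → Set) → ℕ → Set
InspAtMost {N} G S k = Σ (List (Part N)) λ parts →
  IsInducedStarPartition G S parts × length parts ≤ k

insertV : ∀ {N} → Fin N → (Fin N → Bool) → Fin N → Set
insertV x X v = v ≡ x ⊎ X v ≡ true

{-# OPTIONS --safe #-}
module Submission where

open import Defs hiding (sym)
open import Data.Nat as ℕ using (ℕ; zero; suc; _+_; _*_; _∸_; _^_; _≤_; _<_; _≡ᵇ_; s≤s; z≤n)
import Data.Nat.Properties as ℕ
open import Data.Nat.Solver using (module +-*-Solver)
open import Data.Bool using (Bool; true; false; _∨_)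
open import Data.Bool.Properties as Bool using (∨-identityʳ; ¬-not)
open import Data.Empty using (⊥-elim)
open import Data.Fin as Fin using (Fin; zero; suc; toℕ; splitAt)
import Data.Fin.Properties as Fin
open import Data.Fin.Properties using (toℕ-injective; toℕ<n; splitAt⁻¹-↑ˡ; splitAt⁻¹-↑ʳ; toℕ-↑ˡ; toℕ-↑ʳ)
open import Data.List using (List; []; _∷_; [_]; _++_; length; lookup; concatMap; filter; allFin)
open import Data.List.Properties using (concatMap-++; ++-identityʳ; length-++)
open import Data.List.Membership.Propositional using (_∈_; _∉_; find)
open import Data.List.Membership.Propositional.Properties using (∈-lookup; ∈-++⁻; ∈-++⁺ˡ; ∈-++⁺ʳ; ∈-filter⁺; ∈-filter⁻; ∈-allFin)
open import Data.List.Relation.Unary.All as All using (All; []; _∷_)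
import Data.List.Relation.Unary.All.Properties as All
open import Data.List.Relation.Unary.All.Properties using (¬Any⇒All¬)
open import Data.List.Relation.Unary.AllPairs as AllPairs using (AllPairs; []; _∷_)
open import Data.List.Relation.Unary.Any using (any?; here; there)
open import Data.List.Relation.Unary.Unique.Propositional using (Unique)
import Data.List.Relation.Unary.Unique.Propositional.Properties as Unique
open import Data.Product using (Σ; ∃₂; _×_; _,_; proj₁; proj₂)
open import Data.Sum as Sum using (_⊎_; inj₁; inj₂)
import Data.Vec.Functional as V
open import Function using (_∘_; id)
open import Function.Bundles using (mk⇔)
open import Function.Definitions using (Injective)
open import Relation.Binary using (Symmetric; Decidable)
open import Relation.Binary.PropositionalEquality using (_≡_; _≢_; refl; sym; trans; cong; cong₂; subst)
open import Relation.Nullary using (¬_; Dec; yes; no; does; contradiction; ¬?; _×-dec_)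
open import Relation.Nullary.Decidable using (dec-true; dec-false; does-⇔)
import Relation.Unary as U

-- Let Q = c ∷ P be a clique and Y a set of common neighbours of Q with |Q| + t + 2 = n. By
-- induction on t, {c} ∪ Y has an induced star partition into at most 1 + q + ⋯ + q^t parts,
-- q = R(n−1,n) − 1; for Q = [x] this is ξ_{n,n−2}. If Y is independent, {c} ∪ Y is one star.
-- Otherwise take an edge uv in Y: the parts {u} ∪ (Y ∩ N(u)) and {v} ∪ (Y ∩ N(v)) are
-- handled by induction with the larger cliques u ∷ Q and v ∷ Q (for t = 0 an edge would
-- give a K_n), and the process continues on the rest of Y, which is anticomplete to u, v.
-- The triangles c u v collected on the way form an induced S̃_k centred at c, so
-- S̃_n-freeness stops it after at most n − 1 rounds, each costing 2(1 + ⋯ + q^(t−1)) parts.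
-- As R(n−1,n) > (n−1)(n−2) (witnessed by n − 1 disjoint copies of K_(n−2)), 2(n−1) ≤ q.

geometricSum : ℕ → ℕ → ℕ
geometricSum q zero    = 1
geometricSum q (suc t) = suc (q * geometricSum q t)

geometricSum-*-suc : ∀ p t → geometricSum (suc p) t * p + 1 ≡ suc p ^ suc t
geometricSum-*-suc p zero    = solve 1 (λ p → con 1 :* p :+ con 1 := (con 1 :+ p) :* con 1) refl p
  where open +-*-Solver
geometricSum-*-suc p (suc t) = trans
  (solve 2 (λ s p → (con 1 :+ (con 1 :+ p) :* s) :* p :+ con 1 := (con 1 :+ p) :* (s :* p :+ con 1))
     refl (geometricSum (suc p) t) p)
  (cong (suc p *_) (geometricSum-*-suc p t))
  where open +-*-Solver

geometricSum-*-pred : ∀ q t → geometricSum q t * (q ∸ 1) ≡ q ^ suc t ∸ 1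
geometricSum-*-pred zero    t = ℕ.*-zeroʳ (geometricSum 0 t)
geometricSum-*-pred (suc p) t =
  trans (sym (ℕ.m+n∸n≡m _ 1)) (cong (_∸ 1) (geometricSum-*-suc p t))

does⇒ : ∀ {a} {A : Set a} (a? : Dec A) → does a? ≡ true → A
does⇒ (yes a) _ = a

lookup-AllPairs : ∀ {A : Set} {R : A → A → Set} → Symmetric R → {xs : List A} → AllPairs R xs →
  ∀ i j → i ≢ j → R (lookup xs i) (lookup xs j)
lookup-AllPairs R-sym (_ ∷ _)       zero    zero    i≢j = contradiction refl i≢j
lookup-AllPairs R-sym (Rx ∷ _)      zero    (suc j) _   = All.lookup Rx (∈-lookup j)
lookup-AllPairs R-sym (Rx ∷ _)      (suc i) zero    _   = R-sym (All.lookup Rx (∈-lookup i))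
lookup-AllPairs R-sym (_ ∷ Rxs)     (suc i) (suc j) i≢j = lookup-AllPairs R-sym Rxs i j (i≢j ∘ cong suc)

related-or-AllPairs¬ : ∀ {A : Set} {R : A → A → Set} → Decidable R → (xs : List A) →
  (∃₂ λ u v → u ∈ xs × v ∈ xs × R u v) ⊎ AllPairs (λ u v → ¬ R u v) xs
related-or-AllPairs¬ R? [] = inj₂ []
related-or-AllPairs¬ R? (x ∷ xs) with any? (R? x) xs
... | yes Rx = let (v , v∈xs , Rxv) = find Rx in inj₁ (x , v , here refl , there v∈xs , Rxv)
... | no ¬Rx with related-or-AllPairs¬ R? xs
...   | inj₁ (u , v , u∈ , v∈ , Ruv) = inj₁ (u , v , there u∈ , there v∈ , Ruv)
...   | inj₂ ind = inj₂ (¬Any⇒All¬ xs ¬Rx ∷ ind)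

All-filter : ∀ {A : Set} {P Q R : A → Set} (P? : U.Decidable P) {xs} → All Q xs →
  (∀ {x} → P x → Q x → R x) → All R (filter P? xs)
All-filter P? {xs} Qxs PQ⇒R =
  All.zipWith (λ (Px , Qx) → PQ⇒R Px Qx) (All.all-filter P? xs , All.filter⁺ P? Qxs)

true≢false-by : ∀ {a b : Bool} → a ≡ true → b ≡ false → a ≢ b
true≢false-by refl refl ()

TwinFree : ∀ {V : Set} → (V → V → Bool) → Set
TwinFree {V} H = ∀ p q → (∀ w → H p w ≡ H q w) → p ≡ q

completeAdj-diag : ∀ {n} (i : Fin n) → completeAdj n i i ≡ false
completeAdj-diag i with i Fin.≟ i
... | yes _   = refl
... | no  i≢i = contradiction refl i≢i

completeAdj-off : ∀ {n} {i j : Fin n} → i ≢ j → completeAdj n i j ≡ true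
completeAdj-off {i = i} {j} i≢j with i Fin.≟ j
... | yes i≡j = contradiction i≡j i≢j
... | no  _   = refl

completeAdj-twinFree : ∀ n → TwinFree (completeAdj n)
completeAdj-twinFree n i j rows with i Fin.≟ j
... | yes i≡j = i≡j
... | no  i≢j = contradiction (sym (rows i)) (true≢false-by (completeAdj-off (i≢j ∘ sym)) (completeAdj-diag i))

module S̃ where

  data Vertex (m : ℕ) : Set where
    x₁  : Vertex m
    y z : Fin m → Vertex m

  adjacency : ∀ {m} → Vertex m → Vertex m → Bool
  adjacency x₁    x₁    = false
  adjacency x₁    (y _) = true
  adjacency x₁    (z _) = true
  adjacency (y _) x₁    = true
  adjacency (z _) x₁    = true
  adjacency (y _) (y _) = false
  adjacency (z _) (z _) = false
  adjacency (y i) (z j) = does (i Fin.≟ j)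
  adjacency (z i) (y j) = does (j Fin.≟ i)

  adjacency-twinFree : ∀ {m} → TwinFree (adjacency {m})
  adjacency-twinFree x₁    x₁    rows = refl
  adjacency-twinFree x₁    (y _) rows with () ← rows x₁
  adjacency-twinFree x₁    (z _) rows with () ← rows x₁
  adjacency-twinFree (y _) x₁    rows with () ← rows x₁
  adjacency-twinFree (z _) x₁    rows with () ← rows x₁
  adjacency-twinFree (y i) (y j) rows with i Fin.≟ j
  ... | yes refl = refl
  ... | no  i≢j  = contradiction (rows (z i)) (true≢false-by (dec-true (i Fin.≟ i) refl) (dec-false (j Fin.≟ i) (i≢j ∘ sym)))
  adjacency-twinFree (z i) (z j) rows with i Fin.≟ j
  ... | yes refl = refl
  ... | no  i≢j  = contradiction (rows (y i)) (true≢false-by (dec-true (i Fin.≟ i) refl) (dec-false (i Fin.≟ j) i≢j))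
  adjacency-twinFree (y i) (z j) rows = contradiction (rows (z i)) (true≢false-by (dec-true (i Fin.≟ i) refl) refl)
  adjacency-twinFree (z i) (y j) rows = contradiction (sym (rows (z j))) (true≢false-by (dec-true (j Fin.≟ j) refl) refl)

  -- Vertex 0 is x₁, vertex 1 + i is y i and vertex 1 + m + i is z i, as in stildeAdj.
  index : ∀ {m} → Vertex m → ℕ
  index x₁        = 0
  index (y i)     = suc (toℕ i)
  index {m} (z i) = suc (m + toℕ i)

  decode : ∀ m → Fin (suc (m + m)) → Vertex m
  decode m zero    = x₁
  decode m (suc k) = Sum.[ y , z ] (splitAt m k)

  toℕ-decode : ∀ m a → toℕ a ≡ index (decode m a)
  toℕ-decode m zero = refl
  toℕ-decode m (suc k) with splitAt m k in eq
  ... | inj₁ i = cong suc (trans (cong toℕ (sym (splitAt⁻¹-↑ˡ eq))) (toℕ-↑ˡ i m))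
  ... | inj₂ j = cong suc (trans (cong toℕ (sym (splitAt⁻¹-↑ʳ eq))) (toℕ-↑ʳ m j))

  decode-injective : ∀ m → Injective _≡_ _≡_ (decode m)
  decode-injective m {a} {b} e = toℕ-injective (trans (toℕ-decode m a) (trans (cong index e) (sym (toℕ-decode m b))))

  ≡ᵇ-< : ∀ {a b} → a < b → (a ≡ᵇ b) ≡ false
  ≡ᵇ-< {a} {b} a<b = dec-false (a ℕ.≟ b) (ℕ.<⇒≢ a<b)

  ≡ᵇ-mate : ∀ {m} (i j : Fin m) → (m + toℕ j ≡ᵇ toℕ i + m) ≡ does (i Fin.≟ j)
  ≡ᵇ-mate {m} i j = does-⇔ (mk⇔ to from) (m + toℕ j ℕ.≟ toℕ i + m) (i Fin.≟ j)
    where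
    to : m + toℕ j ≡ toℕ i + m → i ≡ j
    to e = toℕ-injective (sym (ℕ.+-cancelˡ-≡ m _ _ (trans e (ℕ.+-comm (toℕ i) m))))
    from : i ≡ j → m + toℕ j ≡ toℕ i + m
    from refl = ℕ.+-comm m (toℕ i)

  stildeEdge-index : ∀ {m} (p q : Vertex m) →
    stildeEdge m (index p) (index q) ∨ stildeEdge m (index q) (index p) ≡ adjacency p q
  stildeEdge-index x₁    x₁    = refl
  stildeEdge-index x₁    (y _) = refl
  stildeEdge-index x₁    (z _) = refl
  stildeEdge-index (y _) x₁    = refl
  stildeEdge-index (z _) x₁    = refl
  stildeEdge-index {m} (y i) (y j) = cong₂ _∨_
    (≡ᵇ-< (ℕ.<-≤-trans (toℕ<n j) (ℕ.m≤n+m m (toℕ i))))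
    (≡ᵇ-< (ℕ.<-≤-trans (toℕ<n i) (ℕ.m≤n+m m (toℕ j))))
  stildeEdge-index {m} (z i) (z j) = cong₂ _∨_
    (≡ᵇ-< (ℕ.<-≤-trans (ℕ.+-monoʳ-< m (toℕ<n j)) (ℕ.+-monoˡ-≤ m (ℕ.m≤m+n m (toℕ i)))))
    (≡ᵇ-< (ℕ.<-≤-trans (ℕ.+-monoʳ-< m (toℕ<n i)) (ℕ.+-monoˡ-≤ m (ℕ.m≤m+n m (toℕ j)))))
  stildeEdge-index {m} (y i) (z j) = trans
    (cong₂ _∨_ (≡ᵇ-mate i j) (≡ᵇ-< (ℕ.<-≤-trans (toℕ<n i) (ℕ.m≤n+m m (m + toℕ j)))))
    (∨-identityʳ _)
  stildeEdge-index {m} (z i) (y j) = cong₂ _∨_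
    (≡ᵇ-< (ℕ.<-≤-trans (toℕ<n j) (ℕ.m≤n+m m (m + toℕ i))))
    (≡ᵇ-mate j i)

  stildeAdj-decode : ∀ m a b → stildeAdj m a b ≡ adjacency (decode m a) (decode m b)
  stildeAdj-decode m a b = trans
    (cong₂ (λ u v → stildeEdge m u v ∨ stildeEdge m v u) (toℕ-decode m a) (toℕ-decode m b))
    (stildeEdge-index (decode m a) (decode m b))

Outside : ∀ {N} → (Fin N → Set) → Fin N → Fin N → Set
Outside D w v = ¬ D v × v ≢ w

outside? : ∀ {N} {D : Fin N → Set} → U.Decidable D → ∀ w → U.Decidable (Outside D w)
outside? D? w v = ¬? (D? v) ×-dec ¬? (v Fin.≟ w)

module _ {N : ℕ} (G : Graph N) where

  Adj NonAdj : Fin N → Fin N → Set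
  Adj    u v = adj G u v ≡ true
  NonAdj u v = adj G u v ≡ false

  Adj-sym : ∀ {u v} → Adj u v → Adj v u
  Adj-sym {u} {v} = trans (Graph.sym G v u)

  NonAdj-sym : ∀ {u v} → NonAdj u v → NonAdj v u
  NonAdj-sym {u} {v} = trans (Graph.sym G v u)

  Adj⇒≢ : ∀ {u v} → Adj u v → u ≢ v
  Adj⇒≢ {u} Auv refl = true≢false-by Auv (irrefl G u) refl

  edge-or-independent : ∀ Y → (∃₂ λ u v → u ∈ Y × v ∈ Y × Adj u v) ⊎ AllPairs NonAdj Y
  edge-or-independent Y = Sum.map₂ (AllPairs.map ¬-not) (related-or-AllPairs¬ (λ u v → adj G u v Bool.≟ true) Y)

  twinFree⇒injective : ∀ {V : Set} {H : V → V → Bool} (g : V → Fin N) →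
    (∀ p q → adj G (g p) (g q) ≡ H p q) → TwinFree H → Injective _≡_ _≡_ g
  twinFree⇒injective g g-adj twinFree {p} {q} gp≡gq = twinFree p q λ w →
    trans (sym (g-adj p w)) (trans (cong (λ v → adj G v (g w)) gp≡gq) (g-adj q w))

  clique⇒completeCopy : ∀ {Q} → AllPairs Adj Q → InducedCopy (completeAdj (length Q)) G
  clique⇒completeCopy {Q} clique =
    lookup Q , twinFree⇒injective (lookup Q) lookup-adj (completeAdj-twinFree _) , lookup-adj
    where
    lookup-adj : ∀ i j → adj G (lookup Q i) (lookup Q j) ≡ completeAdj (length Q) i j
    lookup-adj i j with i Fin.≟ j
    ... | yes refl = irrefl G (lookup Q i)
    ... | no  i≢j  = lookup-AllPairs Adj-sym clique i j i≢j

  Anticomplete : Fin N → ∀ {k} → (Fin k → Fin N) → (Fin k → Fin N) → Set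
  Anticomplete v ys zs = ∀ i → NonAdj v (ys i) × NonAdj v (zs i)

  -- An induced S̃_k in G with x₁ ↦ c, y i ↦ ys i and z i ↦ zs i.
  record Windmill (c : Fin N) {k} (ys zs : Fin k → Fin N) : Set where
    field
      hub-y : ∀ i → Adj c (ys i)
      hub-z : ∀ i → Adj c (zs i)
      blade : ∀ i → Adj (ys i) (zs i)
      apart : ∀ {i j} → i ≢ j → NonAdj (ys i) (ys j) × NonAdj (ys i) (zs j) × NonAdj (zs i) (zs j)

  Windmill-∷ : ∀ {c k} {ys zs : Fin k → Fin N} {u v} → Windmill c ys zs →
    Adj c u → Adj c v → Adj u v → Anticomplete u ys zs → Anticomplete v ys zs →
    Windmill c (u V.∷ ys) (v V.∷ zs)
  Windmill-∷ {ys = ys} {zs} {u} {v} W cu cv uv u-anti v-anti = record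
    { hub-y = λ { zero → cu ; (suc i) → hub-y i }
    ; hub-z = λ { zero → cv ; (suc i) → hub-z i }
    ; blade = λ { zero → uv ; (suc i) → blade i }
    ; apart = apart′
    }
    where
    open Windmill W
    apart′ : ∀ {i j} → i ≢ j → NonAdj ((u V.∷ ys) i) ((u V.∷ ys) j)
      × NonAdj ((u V.∷ ys) i) ((v V.∷ zs) j) × NonAdj ((v V.∷ zs) i) ((v V.∷ zs) j)
    apart′ {zero}  {zero}  0≢0 = contradiction refl 0≢0
    apart′ {zero}  {suc j} _   = let (uy , uz) = u-anti j ; (_ , vz) = v-anti j in uy , uz , vz
    apart′ {suc i} {zero}  _   = let (uy , _) = u-anti i ; (vy , vz) = v-anti i in
      NonAdj-sym uy , NonAdj-sym vy , NonAdj-sym vz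
    apart′ {suc i} {suc j} i≢j = apart (i≢j ∘ cong suc)

  windmill⇒S̃copy : ∀ {c k} {ys zs : Fin k → Fin N} → Windmill c ys zs → InducedCopy (stildeAdj k) G
  windmill⇒S̃copy {c} {k} {ys} {zs} W =
    g ∘ S̃.decode k ,
    (λ e → S̃.decode-injective k (twinFree⇒injective g g-adj S̃.adjacency-twinFree e)) ,
    λ a b → trans (g-adj (S̃.decode k a) (S̃.decode k b)) (sym (S̃.stildeAdj-decode k a b))
    where
    open Windmill W
    g : S̃.Vertex k → Fin N
    g S̃.x₁    = c
    g (S̃.y i) = ys i
    g (S̃.z i) = zs i
    g-adj : ∀ p q → adj G (g p) (g q) ≡ S̃.adjacency p q
    g-adj S̃.x₁    S̃.x₁    = irrefl G c
    g-adj S̃.x₁    (S̃.y i) = hub-y i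
    g-adj S̃.x₁    (S̃.z i) = hub-z i
    g-adj (S̃.y i) S̃.x₁    = Adj-sym (hub-y i)
    g-adj (S̃.z i) S̃.x₁    = Adj-sym (hub-z i)
    g-adj (S̃.y i) (S̃.y j) with i Fin.≟ j
    ... | yes refl = irrefl G (ys i)
    ... | no  i≢j  = proj₁ (apart i≢j)
    g-adj (S̃.z i) (S̃.z j) with i Fin.≟ j
    ... | yes refl = irrefl G (zs i)
    ... | no  i≢j  = proj₂ (proj₂ (apart i≢j))
    g-adj (S̃.y i) (S̃.z j) with i Fin.≟ j
    ... | yes refl = blade i
    ... | no  i≢j  = proj₁ (proj₂ (apart i≢j))
    g-adj (S̃.z i) (S̃.y j) = trans (Graph.sym G (zs i) (ys j)) (g-adj (S̃.y j) (S̃.z i))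

  isp-resp : ∀ {S T : Fin N → Set} {ps} → (∀ v → S v → T v) → (∀ v → T v → S v) →
    IsInducedStarPartition G S ps → IsInducedStarPartition G T ps
  isp-resp S⊆T T⊆S (stars , unique , cover) =
    stars , unique , λ v → S⊆T v ∘ proj₁ (cover v) , proj₂ (cover v) ∘ T⊆S v

  isp-++ : ∀ {S T : Fin N → Set} {ps qs} → (∀ v → S v → ¬ T v) →
    IsInducedStarPartition G S ps → IsInducedStarPartition G T qs →
    IsInducedStarPartition G (λ v → S v ⊎ T v) (ps ++ qs)
  isp-++ {ps = ps} {qs} S∩T=∅ (stars₁ , unique₁ , cover₁) (stars₂ , unique₂ , cover₂)
    rewrite concatMap-++ partVerts ps qs =
    All.++⁺ stars₁ stars₂ ,
    Unique.++⁺ unique₁ unique₂ (λ (v∈ps , v∈qs) → S∩T=∅ _ (proj₁ (cover₁ _) v∈ps) (proj₁ (cover₂ _) v∈qs)) ,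
    λ v → Sum.map (proj₁ (cover₁ v)) (proj₁ (cover₂ v)) ∘ ∈-++⁻ (concatMap partVerts ps) ,
          Sum.[ ∈-++⁺ˡ ∘ proj₂ (cover₁ v) , ∈-++⁺ʳ _ ∘ proj₂ (cover₂ v) ]

  isp-star : ∀ {c Y} → All (Adj c) Y → AllPairs NonAdj Y → Unique (c ∷ Y) →
    IsInducedStarPartition G (_∈ c ∷ Y) [ (c , Y) ]
  isp-star {c} {Y} spokes independent unique rewrite ++-identityʳ (c ∷ Y) =
    (spokes , independent) ∷ [] , unique , λ v → id , id

  InspAtMost-mono : ∀ {S a b} → a ≤ b → InspAtMost G S a → InspAtMost G S b
  InspAtMost-mono a≤b (ps , isp , ps≤a) = ps , isp , ℕ.≤-trans ps≤a a≤b

  insp-split : ∀ {c w Y} {D : Fin N → Set} (D? : U.Decidable D) → c ∉ Y → w ∈ Y →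
    ∀ {a b} → InspAtMost G (_∈ w ∷ filter D? Y) a → InspAtMost G (_∈ c ∷ filter (outside? D? w) Y) b →
    InspAtMost G (_∈ c ∷ Y) (a + b)
  insp-split {c} {w} {Y} {D} D? c∉Y w∈Y (ps , isp₁ , ps≤a) (qs , isp₂ , qs≤b) =
    ps ++ qs ,
    isp-resp merge split (isp-++ disjoint isp₁ isp₂) ,
    ℕ.≤-trans (ℕ.≤-reflexive (length-++ ps)) (ℕ.+-mono-≤ ps≤a qs≤b)
    where
    filter⁻-D : ∀ {v} → v ∈ filter D? Y → v ∈ Y × D v
    filter⁻-D = ∈-filter⁻ D? {xs = Y}
    filter⁻-outside : ∀ {v} → v ∈ filter (outside? D? w) Y → v ∈ Y × Outside D w v
    filter⁻-outside = ∈-filter⁻ (outside? D? w) {xs = Y}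
    disjoint : ∀ v → v ∈ w ∷ filter D? Y → ¬ v ∈ c ∷ filter (outside? D? w) Y
    disjoint v (here refl)  (here refl)  = c∉Y w∈Y
    disjoint v (here refl)  (there v∈R)  = proj₂ (proj₂ (filter⁻-outside v∈R)) refl
    disjoint v (there v∈D)  (here refl)  = c∉Y (proj₁ (filter⁻-D v∈D))
    disjoint v (there v∈D)  (there v∈R)  = proj₁ (proj₂ (filter⁻-outside v∈R)) (proj₂ (filter⁻-D v∈D))
    merge : ∀ v → v ∈ w ∷ filter D? Y ⊎ v ∈ c ∷ filter (outside? D? w) Y → v ∈ c ∷ Y
    merge v (inj₁ (here refl)) = there w∈Y
    merge v (inj₁ (there v∈D)) = there (proj₁ (filter⁻-D v∈D))
    merge v (inj₂ (here refl)) = here refl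
    merge v (inj₂ (there v∈R)) = there (proj₁ (filter⁻-outside v∈R))
    split : ∀ v → v ∈ c ∷ Y → v ∈ w ∷ filter D? Y ⊎ v ∈ c ∷ filter (outside? D? w) Y
    split v (here v≡c) = inj₂ (here v≡c)
    split v (there v∈Y) with v Fin.≟ w | D? v
    ... | yes v≡w | _      = inj₁ (here v≡w)
    ... | no  _   | yes Dv = inj₁ (there (∈-filter⁺ D? v∈Y Dv))
    ... | no  v≢w | no ¬Dv = inj₂ (there (∈-filter⁺ (outside? D? w) v∈Y (¬Dv , v≢w)))

module DisjointCliques (m k : ℕ) where

  copy : Fin (m * k) → Fin m
  copy = Fin.quotient k

  position : Fin (m * k) → Fin k
  position = Fin.remainder {m} k

  SameCopy : Fin (m * k) → Fin (m * k) → Set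
  SameCopy v w = copy v ≡ copy w × v ≢ w

  sameCopy? : ∀ v w → Dec (SameCopy v w)
  sameCopy? v w = (copy v Fin.≟ copy w) ×-dec ¬? (v Fin.≟ w)

  SameCopy-sym : ∀ {v w} → SameCopy v w → SameCopy w v
  SameCopy-sym (copy≡ , v≢w) = sym copy≡ , v≢w ∘ sym

  graph : Graph (m * k)
  graph = record
    { adj    = λ v w → does (sameCopy? v w)
    ; sym    = λ v w → does-⇔ (mk⇔ SameCopy-sym SameCopy-sym) (sameCopy? v w) (sameCopy? w v)
    ; irrefl = λ v → dec-false (sameCopy? v v) λ (_ , v≢v) → v≢v refl
    }

  copy-position-injective : ∀ {v w} → copy v ≡ copy w → position v ≡ position w → v ≡ w
  copy-position-injective {v} {w} copy≡ position≡ = trans (sym (Fin.combine-remQuot {m} k v))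
    (trans (cong₂ Fin.combine copy≡ position≡) (Fin.combine-remQuot {m} k w))

  noClique : ¬ HasClique graph (suc k)
  noClique (f , f-inj , clique) with Fin.pigeonhole (ℕ.n<1+n k) (position ∘ f)
  ... | i , j , i<j , position≡ = i≢j (f-inj (copy-position-injective copy≡ position≡))
    where
    i≢j = Fin.<⇒≢ i<j
    copy≡ = proj₁ (does⇒ (sameCopy? (f i) (f j)) (clique i j i≢j))

  noIndep : ¬ HasIndep graph (suc m)
  noIndep (f , f-inj , independent) with Fin.pigeonhole (ℕ.n<1+n m) (copy ∘ f)
  ... | i , j , i<j , copy≡ =
    true≢false-by (dec-true (sameCopy? (f i) (f j)) (copy≡ , i≢j ∘ f-inj)) (independent i j i≢j) refl
    where
    i≢j = Fin.<⇒≢ i<j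

ramsey-lowerBound : ∀ m k r → RamseyProperty (suc k) (suc m) r → m * k < r
ramsey-lowerBound m k r ramsey = ℕ.≰⇒> λ r≤mk →
  Sum.[ noClique , noIndep ] (ramsey (m * k) r≤mk graph)
  where open DisjointCliques m k

module Partition {N : ℕ} (G : Graph N) (n q : ℕ)
  (K-free : Free (completeAdj n) G) (S̃-free : Free (stildeAdj n) G)
  -- Only needed for t ≥ 1, which forces n ≥ 4; for n = 3 it fails (q = R(2,3) − 1 = 2).
  (budget : 4 ≤ n → (n ∸ 1) + (n ∸ 1) ≤ q) where

  CommonNeighbours : List (Fin N) → List (Fin N) → Set
  CommonNeighbours Q Y = All (λ v → All (Adj G v) Q) Y

  ∉-common : ∀ {c P Y} → CommonNeighbours (c ∷ P) Y → c ∉ Y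
  ∉-common common c∈Y = Adj⇒≢ G (All.head (All.lookup common c∈Y)) refl

  star : ∀ {c P Y k} → CommonNeighbours (c ∷ P) Y → Unique Y → AllPairs (NonAdj G) Y →
    InspAtMost G (_∈ c ∷ Y) (suc k)
  star {c} {Y = Y} common unique independent =
    [ (c , Y) ] ,
    isp-star G (All.map (Adj-sym G ∘ All.head) common) independent
      (All.map (λ vc c≡v → Adj⇒≢ G (All.head vc) (sym c≡v)) common ∷ unique) ,
    s≤s z≤n

  Claim : ℕ → Set
  Claim t = ∀ {c P Y} → AllPairs (Adj G) (c ∷ P) → CommonNeighbours (c ∷ P) Y → Unique Y →
    suc (suc (t + length (c ∷ P))) ≡ n → InspAtMost G (_∈ c ∷ Y) (geometricSum q t)

  partition₀ : Claim 0
  partition₀ {Y = Y} clique common unique len with edge-or-independent G Y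
  ... | inj₂ independent = star common unique independent
  ... | inj₁ (u , v , u∈Y , v∈Y , uv) = ⊥-elim (K-free (subst (λ s → InducedCopy (completeAdj s) G) len
    (clique⇒completeCopy G ((uv ∷ All.lookup common u∈Y) ∷ All.lookup common v∈Y ∷ clique))))

  module Blades {t} (partition : Claim t) {c P} (clique : AllPairs (Adj G) (c ∷ P))
    (len : suc (suc (suc t + length (c ∷ P))) ≡ n) where

    B : ℕ
    B = geometricSum q t

    partition-near : ∀ {Y w} → CommonNeighbours (c ∷ P) Y → Unique Y → w ∈ Y →
      ∀ {D : Fin N → Set} (D? : U.Decidable D) → (∀ {x} → D x → Adj G w x) →
      InspAtMost G (_∈ w ∷ filter D? Y) B
    partition-near {w = w} common unique w∈Y D? D⇒Adj = partition
      (All.lookup common w∈Y ∷ clique)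
      (All-filter D? common λ Dx xQ → Adj-sym G (D⇒Adj Dx) ∷ xQ)
      (Unique.filter⁺ D? unique)
      (trans (cong (λ s → suc (suc s)) (ℕ.+-suc t (length (c ∷ P)))) len)

    add-blade : ∀ {k} {ys zs : Fin k → Fin N} {Y u v} → Windmill G c ys zs →
      CommonNeighbours (c ∷ P) Y → All (λ w → Anticomplete G w ys zs) Y →
      u ∈ Y → v ∈ Y → Adj G u v → Windmill G c (u V.∷ ys) (v V.∷ zs)
    add-blade W common anticomplete u∈Y v∈Y uv = Windmill-∷ G W
      (Adj-sym G (All.head (All.lookup common u∈Y))) (Adj-sym G (All.head (All.lookup common v∈Y))) uv
      (All.lookup anticomplete u∈Y) (All.lookup anticomplete v∈Y)

    mutual
      blades : ∀ b {k} {ys zs : Fin k → Fin N} → Windmill G c ys zs → b + suc k ≡ n →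
        ∀ {Y} → CommonNeighbours (c ∷ P) Y → All (λ w → Anticomplete G w ys zs) Y → Unique Y →
        InspAtMost G (_∈ c ∷ Y) (suc (b * (B + B)))
      blades b W counted {Y} common anticomplete unique with edge-or-independent G Y
      ... | inj₂ independent = star common unique independent
      ... | inj₁ (u , v , u∈Y , v∈Y , uv) = split-on-edge b W counted common anticomplete unique u∈Y v∈Y uv

      split-on-edge : ∀ b {k} {ys zs : Fin k → Fin N} → Windmill G c ys zs → b + suc k ≡ n →
        ∀ {Y} → CommonNeighbours (c ∷ P) Y → All (λ w → Anticomplete G w ys zs) Y → Unique Y →
        ∀ {u v} → u ∈ Y → v ∈ Y → Adj G u v → InspAtMost G (_∈ c ∷ Y) (suc (b * (B + B)))
      split-on-edge zero W counted common anticomplete _ u∈Y v∈Y uv =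
        ⊥-elim (S̃-free (subst (λ s → InducedCopy (stildeAdj s) G) counted
          (windmill⇒S̃copy G (add-blade W common anticomplete u∈Y v∈Y uv))))
      split-on-edge (suc b) {k} {ys} {zs} W counted {Y} common anticomplete unique {u} {v} u∈Y v∈Y uv =
        InspAtMost-mono G (ℕ.≤-reflexive count)
          (insp-split G near-u? (∉-common common) u∈Y
            (partition-near common unique u∈Y near-u? proj₁)
            (insp-split G near-v? (∉-common common₁) v∈Y₁
              (partition-near common₁ unique₁ v∈Y₁ near-v? id)
              (blades b (add-blade W common anticomplete u∈Y v∈Y uv) (trans (ℕ.+-suc b (suc k)) counted)
                (All.filter⁺ far-v? common₁) anticomplete-R (Unique.filter⁺ far-v? unique₁))))
        where
        Near-u : Fin N → Set
        Near-u w = Adj G u w × w ≢ v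
        near-u? : U.Decidable Near-u
        near-u? w = (adj G u w Bool.≟ true) ×-dec ¬? (w Fin.≟ v)
        near-v? : U.Decidable (Adj G v)
        near-v? w = adj G v w Bool.≟ true
        far-u? = outside? near-u? u
        far-v? = outside? near-v? v
        common₁ = All.filter⁺ far-u? common
        unique₁ = Unique.filter⁺ far-u? unique
        v∈Y₁ : v ∈ filter far-u? Y
        v∈Y₁ = ∈-filter⁺ far-u? v∈Y ((λ (_ , v≢v) → v≢v refl) , Adj⇒≢ G uv ∘ sym)
        anticomplete₁ : All (λ w → Anticomplete G w ys zs × Outside Near-u u w) (filter far-u? Y)
        anticomplete₁ = All-filter far-u? anticomplete λ out anti → anti , out
        anticomplete-R : All (λ w → Anticomplete G w (u V.∷ ys) (v V.∷ zs)) (filter far-v? (filter far-u? Y))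
        anticomplete-R = All-filter far-v? anticomplete₁ λ where
          (¬vw , w≢v) (anti , (¬near-u , _)) → λ where
            zero    → NonAdj-sym G (¬-not λ uw → ¬near-u (uw , w≢v)) , NonAdj-sym G (¬-not ¬vw)
            (suc i) → anti i
        count : B + (B + suc (b * (B + B))) ≡ suc (suc b * (B + B))
        count = solve 2 (λ B Z → B :+ (B :+ (con 1 :+ Z)) := con 1 :+ ((B :+ B) :+ Z)) refl B (b * (B + B))
          where open +-*-Solver

  partition : ∀ t → Claim t
  partition zero = partition₀
  partition (suc t) {c} {P} clique common unique len =
    InspAtMost-mono G blades-within-budget
      (blades (n ∸ 1) no-blades (ℕ.m∸n+n≡m 1≤n) common (All.map (λ _ ()) common) unique)
    where
    open Blades (partition t) clique len
    no-blades : Windmill G c {0} (λ ()) (λ ())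
    Windmill.hub-y no-blades ()
    Windmill.hub-z no-blades ()
    Windmill.blade no-blades ()
    Windmill.apart no-blades {()}
    4≤n : 4 ≤ n
    4≤n = subst (4 ≤_) len (s≤s (s≤s (s≤s (ℕ.≤-trans (s≤s z≤n) (ℕ.m≤n+m (length (c ∷ P)) t)))))
    1≤n : 1 ≤ n
    1≤n = ℕ.≤-trans (s≤s z≤n) 4≤n
    blades-within-budget : suc ((n ∸ 1) * (B + B)) ≤ suc (q * B)
    blades-within-budget = s≤s (begin
      (n ∸ 1) * (B + B)       ≡⟨ ℕ.*-distribˡ-+ (n ∸ 1) B B ⟩
      (n ∸ 1) * B + (n ∸ 1) * B ≡⟨ ℕ.*-distribʳ-+ B (n ∸ 1) (n ∸ 1) ⟨
      ((n ∸ 1) + (n ∸ 1)) * B ≤⟨ ℕ.*-monoˡ-≤ B (budget 4≤n) ⟩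
      q * B                   ∎)
      where open ℕ.≤-Reasoning

double≤* : ∀ m {k} → 2 ≤ k → m + m ≤ m * k
double≤* m {k} 2≤k = begin
  m + m ≡⟨ cong (m +_) (sym (ℕ.+-identityʳ m)) ⟩
  2 * m ≡⟨ ℕ.*-comm 2 m ⟩
  m * 2 ≤⟨ ℕ.*-monoʳ-≤ m 2≤k ⟩
  m * k ∎
  where open ℕ.≤-Reasoning

double≤pred-ramsey : ∀ n r → RamseyProperty (n ∸ 1) n r → 4 ≤ n → (n ∸ 1) + (n ∸ 1) ≤ r ∸ 1
double≤pred-ramsey (suc (suc (suc (suc j)))) r ramsey (s≤s (s≤s (s≤s (s≤s _)))) =
  ℕ.≤-trans (double≤* (suc (suc (suc j))) (s≤s (s≤s z≤n)))
    (ℕ.∸-monoˡ-≤ 1 (ramsey-lowerBound (suc (suc (suc j))) (suc (suc j)) r ramsey))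

*pred≤geometricSum : ∀ {ℓ} q t → ℓ ≤ geometricSum q t → ℓ * (q ∸ 1) ≤ q ^ suc t ∸ 1
*pred≤geometricSum q t ℓ≤ = ℕ.≤-trans (ℕ.*-monoˡ-≤ (q ∸ 1) ℓ≤) (ℕ.≤-reflexive (geometricSum-*-pred q t))

lemma2p3 : (n : ℕ) → 3 ≤ n → (r : ℕ) → IsRamseyNumber (n ∸ 1) n r →
    {N : ℕ} (G : Graph N) → Free (completeAdj n) G → Free (stildeAdj n) G →
    (x : Fin N) (X : Fin N → Bool) → (∀ v → X v ≡ true → adj G x v ≡ true) →
    Σ (List (Part N)) λ parts → IsInducedStarPartition G (insertV x X) parts ×
    length parts * (r ∸ 2) ≤ (r ∸ 1) ^ (n ∸ 2) ∸ 1
lemma2p3 n@(suc (suc (suc j))) (s≤s (s≤s (s≤s _))) r (ramsey , _) {N} G K-free S̃-free x X X⊆N[x] =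
  parts , isp-resp G into from isp ,
  subst (λ s → length parts * s ≤ (r ∸ 1) ^ suc j ∸ 1) (ℕ.∸-+-assoc r 1 1) (*pred≤geometricSum (r ∸ 1) j parts≤)
  where
  open Partition G n (r ∸ 1) K-free S̃-free (double≤pred-ramsey n r ramsey)
  X? : U.Decidable (λ v → X v ≡ true)
  X? v = X v Bool.≟ true
  Y = filter X? (allFin N)
  neighbours : CommonNeighbours [ x ] Y
  neighbours = All.map (λ Xv → Adj-sym G (X⊆N[x] _ Xv) ∷ []) (All.all-filter X? (allFin N))
  into : ∀ v → v ∈ x ∷ Y → insertV x X v
  into v (here v≡x) = inj₁ v≡x
  into v (there v∈Y) = inj₂ (proj₂ (∈-filter⁻ X? {xs = allFin N} v∈Y))
  from : ∀ v → insertV x X v → v ∈ x ∷ Y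
  from v (inj₁ v≡x) = here v≡x
  from v (inj₂ Xv)  = there (∈-filter⁺ X? (∈-allFin v) Xv)
  result = partition j ([] ∷ []) neighbours (Unique.filter⁺ X? (Unique.allFin⁺ N)) (cong (λ s → suc (suc s)) (ℕ.+-comm j 1))
  parts = proj₁ result
  isp = proj₁ (proj₂ result)
  parts≤ = proj₂ (proj₂ result)
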